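{- For all integers $3\le n\le m$, \[ \gamma_{2t}(K_n\Box K_n)\le \gamma_{2t}(K_n\Box K_m)\le \min\{2n,\ \gamma_{2t}(K_n\Box K_n)+m-n\}. \]
   Context: $K_n$ denotes the complete graph on $n$ vertices. The Cartesian product $G\Box H$ has vertex set $V(G)\times V(H)$, with $(u_1,v_1)\sim(u_2,v_2)$ iff either $u_1=u_2$ and $v_1\sim v_2$, or $v_1=v_2$ and $u_1\sim u_2$. A set $S$ of vertices of a graph $G$ is total $2$-dominating if every vertex of $G$ is adjacent to at least two vertices of $S$; $\gamma_{2t}(G)$ is the minimum cardinality of such a set. -}

module Defs where

open import Data.Nat using (ℕ; _*_; _≤_)
open import Data.Fin using (Fin; remQuot)
open import Data.Product using (_×_; Σ; _,_; proj₁; proj₂)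
open import Data.Sum using (_⊎_)
open import Data.Empty using (⊥)
open import Relation.Binary.PropositionalEquality using (_≡_; _≢_; refl; sym)
open import Data.Fin.Subset using (Subset; _∈_; ∣_∣)

record Graph (N : ℕ) : Set₁ where
  field
    Adj    : Fin N → Fin N → Set
    Adj-sym    : ∀ {u v} → Adj u v → Adj v u
    Adj-irrefl : ∀ {u} → Adj u u → ⊥

open Graph public

IsTotal2Dominating : ∀ {N} → Graph N → Subset N → Set
IsTotal2Dominating {N} G S =
  (v : Fin N) → Σ (Fin N) λ a → Σ (Fin N) λ b →
    a ≢ b × a ∈ S × b ∈ S × Adj G v a × Adj G v b

IsGamma2t : ∀ {N} → Graph N → ℕ → Set
IsGamma2t {N} G k =
  Σ (Subset N) (λ S → IsTotal2Dominating G S × ∣ S ∣ ≡ k)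
  × ((S : Subset N) → IsTotal2Dominating G S → k ≤ ∣ S ∣)

K : (n : ℕ) → Graph n
K n = record
  { Adj = λ u v → u ≢ v
  ; Adj-sym = λ p q → p (sym q)
  ; Adj-irrefl = λ p → p refl
  }

fst : ∀ {n} m → Fin (n * m) → Fin n
snd : ∀ {n} m → Fin (n * m) → Fin m
fst {n} m x = proj₁ (remQuot {n} m x)
snd {n} m x = proj₂ (remQuot {n} m x)

_□_ : ∀ {n m} → Graph n → Graph m → Graph (n * m)
_□_ {n} {m} G H = record
  { Adj = A
  ; Adj-sym = λ { (_⊎_.inj₁ (e , a)) → _⊎_.inj₁ (sym e , Adj-sym H a)
                ; (_⊎_.inj₂ (e , a)) → _⊎_.inj₂ (sym e , Adj-sym G a) }
  ; Adj-irrefl = λ { (_⊎_.inj₁ (_ , a)) → Adj-irrefl H a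
                   ; (_⊎_.inj₂ (_ , a)) → Adj-irrefl G a }
  }
  where
  A : Fin (n * m) → Fin (n * m) → Set
  A x y = (fst {n} m x ≡ fst {n} m y × Adj H (snd {n} m x) (snd {n} m y))
        ⊎ (snd {n} m x ≡ snd {n} m y × Adj G (fst {n} m x) (fst {n} m y))

-- Vertices of K n □ K m are the cells (i , j) of an n × m grid, adjacent when they share a row or
-- a column.  Two full columns are total 2-dominating (n ≥ 3), so both numbers are at most 2n, while
-- a set holding two cells in each column has at least 2m ≥ 2n cells.
-- Lower bound, by induction on m > n: if some column of a total 2-dominating set holds at most one
-- cell, move that cell within its row to a column avoiding its two row dominators and delete the
-- column; this dominates K n □ K (m - 1) with no more cells.
-- Upper bound: a minimum set of K n □ K n either holds two cells in every column (an empty row, or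
-- rows holding one cell each, force this), so that it has at least 2n cells, or meets every row and holds two
-- cells in some row x.  In the latter case every added column is dominated after adding its cell in
-- row x: that cell is dominated by the two cells of row x, any other new cell (i , new) by it and by
-- a cell of row i.
module Submission where

open import Data.Empty using (⊥-elim)
open import Data.Fin.Base using (Fin; zero; suc; combine; remQuot; punchIn; punchOut)
open import Data.Fin.Properties
  using (_≟_; any?; all?; ¬∀⟶∃¬; 0≢1+n; suc-injective; combine-injective; remQuot-combine;
         combine-remQuot; punchIn-injective; punchInᵢ≢i; punchOut-injective; punchIn-punchOut)
open import Data.Fin.Subset using (Subset; _∈_; _∉_; ∣_∣; ⊤; _-_; inside; outside)
open import Data.Fin.Subset.Properties
  using (_∈?_; anySubset?; ∈⊤; ∣⊤∣≡n; x∈p∧x≢y⇒x∈p-y; x∈p⇒∣p-x∣<∣p∣)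
open import Data.Nat.Base using (ℕ; zero; suc; _+_; _*_; _∸_; _≤_; _<_; _⊓_; z≤n; s≤s)
open import Data.Nat.Induction using (<-wellFounded)
open import Data.Nat.Properties
  using (≤-refl; ≤-trans; ≤-reflexive; n≤1+n; _<?_; ≮⇒≥; *-comm; *-monoʳ-≤; m≤n+m; m≤m+n;
         m∸n+n≡m; +-comm; ⊓-glb)
open import Data.Product using (Σ; ∃; _×_; _,_; proj₁; proj₂; uncurry; map₂)
open import Data.Sum using (_⊎_; inj₁; inj₂)
open import Data.Vec.Base using ([]; _∷_; lookup; tabulate; here; there)
open import Data.Vec.Properties using (lookup∘tabulate; lookup⇒[]=; []=⇒lookup)
open import Function using (_∘_)
open import Induction.WellFounded using (Acc; acc)
open import Relation.Binary.PropositionalEquality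
  using (_≡_; _≢_; refl; sym; trans; cong; cong₂; subst)
open import Relation.Nullary using (¬_; Dec; yes; no; does)
open import Relation.Nullary.Decidable using (dec-true; decidable-stable; map′; _×-dec_; _⊎-dec_; ¬?)
open import Relation.Unary using (Decidable)

open import Defs

private
  variable
    k n m : ℕ

∣∣-mono-injective : (S : Subset n) (T : Subset m) (f : Fin n → Fin m) →
  (∀ {x} → x ∈ S → f x ∈ T) → (∀ {x y} → x ∈ S → y ∈ S → f x ≡ f y → x ≡ y) →
  ∣ S ∣ ≤ ∣ T ∣
∣∣-mono-injective [] T f into inj = z≤n
∣∣-mono-injective (outside ∷ S) T f into inj =
  ∣∣-mono-injective S T (f ∘ suc) (into ∘ there) λ x y → suc-injective ∘ inj (there x) (there y)
∣∣-mono-injective (inside ∷ S) T f into inj =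
  ≤-trans (s≤s (∣∣-mono-injective S (T - f zero) (f ∘ suc) into′ λ x y →
                  suc-injective ∘ inj (there x) (there y)))
          (x∈p⇒∣p-x∣<∣p∣ (into here))
  where
  into′ : ∀ {x} → x ∈ S → f (suc x) ∈ T - f zero
  into′ x∈S = x∈p∧x≢y⇒x∈p-y (into (there x∈S)) λ e → 0≢1+n (inj here (there x∈S) (sym e))

IsMinimumCardinality : (Subset n → Set) → ℕ → Set
IsMinimumCardinality {n} P c =
  Σ (Subset n) (λ S → P S × ∣ S ∣ ≡ c) × ((S : Subset n) → P S → c ≤ ∣ S ∣)

minimumCardinality : {P : Subset n → Set} → Decidable P → ∃ P → ∃ (IsMinimumCardinality P)
minimumCardinality {P = P} P? (S , pS) = go S pS (<-wellFounded ∣ S ∣)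
  where
  go : ∀ S → P S → Acc _<_ ∣ S ∣ → ∃ (IsMinimumCardinality P)
  go S pS (acc smaller) with anySubset? (λ T → P? T ×-dec (∣ T ∣ <? ∣ S ∣))
  ... | yes (T , pT , T<S) = go T pT (smaller T<S)
  ... | no none = ∣ S ∣ , (S , pS , refl) , λ T pT → ≮⇒≥ λ T<S → none (T , pT , T<S)

Cell : ℕ → ℕ → Set
Cell n m = Fin n × Fin m

cell : Cell n m → Fin (n * m)
cell = uncurry combine

infix 4 _∈ᶜ_ _∉ᶜ_ _∈ᶜ?_ _~_

_∈ᶜ_ : Cell n m → Subset (n * m) → Set
c ∈ᶜ S = cell c ∈ S

_∉ᶜ_ : Cell n m → Subset (n * m) → Set
c ∉ᶜ S = cell c ∉ S

_∈ᶜ?_ : (c : Cell n m) (S : Subset (n * m)) → Dec (c ∈ᶜ S)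
c ∈ᶜ? S = cell c ∈? S

remQuot-injective : {x y : Fin (n * m)} → remQuot {n} m x ≡ remQuot m y → x ≡ y
remQuot-injective {n} {m} {x} {y} e =
  trans (sym (combine-remQuot {n} m x)) (trans (cong cell e) (combine-remQuot {n} m y))

cell-injective : {c d : Cell n m} → cell c ≡ cell d → c ≡ d
cell-injective {c = i , j} {k , l} e with combine-injective i j k l e
... | refl , refl = refl

∈ᶜ-remQuot : {S : Subset (n * m)} {x : Fin (n * m)} → x ∈ S → remQuot {n} m x ∈ᶜ S
∈ᶜ-remQuot {n} {m} {S} {x} = subst (_∈ S) (sym (combine-remQuot {n} m x))

∣∣-mono-injectiveᶜ : (S : Subset (n * m)) (T : Subset k) (f : Cell n m → Fin k) →
  (∀ {c} → c ∈ᶜ S → f c ∈ T) → (∀ {c d} → c ∈ᶜ S → d ∈ᶜ S → f c ≡ f d → c ≡ d) →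
  ∣ S ∣ ≤ ∣ T ∣
∣∣-mono-injectiveᶜ {n} {m} S T f into inj =
  ∣∣-mono-injective S T (f ∘ remQuot {n} m) (into ∘ ∈ᶜ-remQuot {n} {m} {S})
    λ x y → remQuot-injective {n} ∘ inj (∈ᶜ-remQuot {n} {m} {S} x) (∈ᶜ-remQuot {n} {m} {S} y)

gridSubset : {P : Cell n m → Set} → Decidable P → Subset (n * m)
gridSubset {n} {m} P? = tabulate (does ∘ P? ∘ remQuot {n} m)

module _ {P : Cell n m → Set} (P? : Decidable P) where

  lookup-gridSubset : ∀ c → lookup (gridSubset P?) (cell c) ≡ does (P? c)
  lookup-gridSubset c@(i , j) =
    trans (lookup∘tabulate _ (cell c)) (cong (does ∘ P?) (remQuot-combine i j))

  ∈gridSubset⁺ : ∀ {c} → P c → c ∈ᶜ gridSubset P?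
  ∈gridSubset⁺ {c} pc = lookup⇒[]= (cell c) _ (trans (lookup-gridSubset c) (dec-true (P? c) pc))

  ∈gridSubset⁻ : ∀ {c} → c ∈ᶜ gridSubset P? → P c
  ∈gridSubset⁻ {c} c∈ with P? c | trans (sym (lookup-gridSubset c)) ([]=⇒lookup c∈)
  ... | yes pc | _ = pc
  ... | no _   | ()

-- Definitionally, Adj (K n □ K m) x y is remQuot x ~ remQuot y.
_~_ : Cell n m → Cell n m → Set
c ~ d = (proj₁ c ≡ proj₁ d × proj₂ c ≢ proj₂ d) ⊎ (proj₂ c ≡ proj₂ d × proj₁ c ≢ proj₁ d)

_~?_ : (c d : Cell n m) → Dec (c ~ d)
c ~? d = (proj₁ c ≟ proj₁ d ×-dec ¬? (proj₂ c ≟ proj₂ d))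
  ⊎-dec (proj₂ c ≟ proj₂ d ×-dec ¬? (proj₁ c ≟ proj₁ d))

Dominated₂ : (Cell n m → Set) → Cell n m → Set
Dominated₂ {n} {m} M v = Σ (Cell n m) λ p → Σ (Cell n m) λ q → p ≢ q × M p × M q × v ~ p × v ~ q

IsTotal2Dominatingᶜ : (Cell n m → Set) → Set
IsTotal2Dominatingᶜ M = ∀ v → Dominated₂ M v

IsTotal2Dominatingᶜ-mono : {M N : Cell n m → Set} → (∀ {c} → M c → N c) →
  IsTotal2Dominatingᶜ M → IsTotal2Dominatingᶜ N
IsTotal2Dominatingᶜ-mono M⊆N dom v with dom v
... | p , q , p≢q , Mp , Mq , v~p , v~q = p , q , p≢q , M⊆N Mp , M⊆N Mq , v~p , v~q

module _ {S : Subset (n * m)} where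

  toCells : IsTotal2Dominating (K n □ K m) S → IsTotal2Dominatingᶜ (_∈ᶜ S)
  toCells dom v@(i , j) with dom (cell v)
  ... | x , y , x≢y , x∈S , y∈S , v~x , v~y =
    remQuot {n} m x , remQuot {n} m y , x≢y ∘ remQuot-injective {n} ,
    ∈ᶜ-remQuot {n} {m} {S} x∈S , ∈ᶜ-remQuot {n} {m} {S} y∈S ,
    subst (_~ remQuot {n} m x) (remQuot-combine i j) v~x ,
    subst (_~ remQuot {n} m y) (remQuot-combine i j) v~y

  fromCells : IsTotal2Dominatingᶜ (_∈ᶜ S) → IsTotal2Dominating (K n □ K m) S
  fromCells dom x with dom (remQuot {n} m x)
  ... | p@(i , j) , q@(k , l) , p≢q , p∈S , q∈S , x~p , x~q =
    cell p , cell q , p≢q ∘ cell-injective , p∈S , q∈S ,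
    subst (remQuot {n} m x ~_) (sym (remQuot-combine i j)) x~p ,
    subst (remQuot {n} m x ~_) (sym (remQuot-combine k l)) x~q

isTotal2Dominating? : Decidable (IsTotal2Dominating (K n □ K m))
isTotal2Dominating? {n} {m} S = all? λ v → any? λ x → any? λ y →
  ¬? (x ≟ y) ×-dec x ∈? S ×-dec y ∈? S ×-dec
  remQuot {n} m v ~? remQuot m x ×-dec remQuot {n} m v ~? remQuot m y

γ₂ₜ-exists : ∃ (IsTotal2Dominating (K n □ K m)) → ∃ (IsGamma2t (K n □ K m))
γ₂ₜ-exists = minimumCardinality isTotal2Dominating?

fresh : 3 ≤ n → (a b : Fin n) → Σ (Fin n) λ c → a ≢ c × b ≢ c
fresh (s≤s (s≤s (s≤s _))) zero          zero          = suc zero , (λ ()) , (λ ())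
fresh (s≤s (s≤s (s≤s _))) zero          (suc zero)    = suc (suc zero) , (λ ()) , (λ ())
fresh (s≤s (s≤s (s≤s _))) zero          (suc (suc _)) = suc zero , (λ ()) , (λ ())
fresh (s≤s (s≤s (s≤s _))) (suc zero)    zero          = suc (suc zero) , (λ ()) , (λ ())
fresh (s≤s (s≤s (s≤s _))) (suc (suc _)) zero          = suc zero , (λ ()) , (λ ())
fresh (s≤s (s≤s (s≤s _))) (suc _)       (suc _)       = zero , (λ ()) , (λ ())

twoColumns : 3 ≤ n → 2 ≤ m →
  Σ (Subset (n * m)) λ S → IsTotal2Dominating (K n □ K m) S × ∣ S ∣ ≤ 2 * n
twoColumns {n} {suc (suc m)} 3≤n (s≤s (s≤s _)) =
  gridSubset InFirstTwo? ,
  fromCells (IsTotal2Dominatingᶜ-mono (∈gridSubset⁺ InFirstTwo?) dominating) ,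
  size
  where
  InFirstTwo : Cell n (2 + m) → Set
  InFirstTwo (_ , j) = j ≡ zero ⊎ j ≡ suc zero

  InFirstTwo? : Decidable InFirstTwo
  InFirstTwo? (_ , j) = j ≟ zero ⊎-dec j ≟ suc zero

  alongColumn : ∀ {i j} → InFirstTwo (i , j) → Dominated₂ InFirstTwo (i , j)
  alongColumn {i} {j} ij∈ with fresh 3≤n i i
  ... | r , i≢r , _ with fresh 3≤n i r
  ...   | r′ , i≢r′ , r≢r′ =
    (r , j) , (r′ , j) , r≢r′ ∘ cong proj₁ , ij∈ , ij∈ , inj₂ (refl , i≢r) , inj₂ (refl , i≢r′)

  dominating : IsTotal2Dominatingᶜ InFirstTwo
  dominating (i , zero)          = alongColumn (inj₁ refl)
  dominating (i , suc zero)      = alongColumn (inj₂ refl)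
  dominating (i , suc (suc _))   =
    (i , zero) , (i , suc zero) , (λ ()) , inj₁ refl , inj₂ refl ,
    inj₁ (refl , λ ()) , inj₁ (refl , λ ())

  squash : Cell n (2 + m) → Cell n 2
  squash (i , zero)  = i , zero
  squash (i , suc _) = i , suc zero

  squash-injective : ∀ {c d} → InFirstTwo c → InFirstTwo d → squash c ≡ squash d → c ≡ d
  squash-injective (inj₁ refl) (inj₁ refl) refl = refl
  squash-injective (inj₂ refl) (inj₂ refl) refl = refl
  squash-injective (inj₁ refl) (inj₂ refl) ()
  squash-injective (inj₂ refl) (inj₁ refl) ()

  size : ∣ gridSubset InFirstTwo? ∣ ≤ 2 * n
  size = ≤-trans
    (∣∣-mono-injectiveᶜ (gridSubset InFirstTwo?) ⊤ (cell ∘ squash) (λ _ → ∈⊤) λ c∈ d∈ →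
      squash-injective (∈gridSubset⁻ InFirstTwo? c∈) (∈gridSubset⁻ InFirstTwo? d∈) ∘ cell-injective)
    (≤-reflexive (trans (∣⊤∣≡n (n * 2)) (*-comm n 2)))

γ₂ₜ-exists′ : 3 ≤ n → 2 ≤ m → ∃ (IsGamma2t (K n □ K m))
γ₂ₜ-exists′ 3≤n 2≤m = γ₂ₜ-exists (map₂ proj₁ (twoColumns 3≤n 2≤m))

γ₂ₜ≤2n : 3 ≤ n → 2 ≤ m → ∀ {c} → IsGamma2t (K n □ K m) c → c ≤ 2 * n
γ₂ₜ≤2n 3≤n 2≤m (_ , minimal) with twoColumns 3≤n 2≤m
... | S , dom , ∣S∣≤2n = ≤-trans (minimal S dom) ∣S∣≤2n

record TwoDistinct (P : Fin n → Set) : Set where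
  constructor pair
  field
    one two : Fin n
    one≢two : one ≢ two
    one∈    : P one
    two∈    : P two

twoDistinct? : {P : Fin n → Set} → Decidable P → Dec (TwoDistinct P)
twoDistinct? P? = map′
  (λ (a , b , a≢b , pa , pb) → pair a b a≢b pa pb) (λ (pair a b a≢b pa pb) → a , b , a≢b , pa , pb)
  (any? λ a → any? λ b → ¬? (a ≟ b) ×-dec P? a ×-dec P? b)

TwoDistinct-map : {P Q : Fin n → Set} → (∀ {a} → P a → Q a) → TwoDistinct P → TwoDistinct Q
TwoDistinct-map P⊆Q (pair a b a≢b pa pb) = pair a b a≢b (P⊆Q pa) (P⊆Q pb)

¬TwoDistinct⇒unique : {P : Fin n → Set} → ¬ TwoDistinct P → ∀ {a b} → P a → P b → a ≡ b
¬TwoDistinct⇒unique ¬two {a} {b} pa pb = decidable-stable (a ≟ b) λ a≢b → ¬two (pair a b a≢b pa pb)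

transpose : Cell n m → Cell m n
transpose (i , j) = j , i

transpose-dominating : {M : Cell n m → Set} →
  IsTotal2Dominatingᶜ M → IsTotal2Dominatingᶜ (M ∘ transpose)
transpose-dominating dom (j , i) with dom (i , j)
... | (a , b) , (a′ , b′) , p≢q , Mp , Mq , v~p , v~q =
  (b , a) , (b′ , a′) , (λ { refl → p≢q refl }) , Mp , Mq , transpose~ v~p , transpose~ v~q
  where
  transpose~ : ∀ {c d : Cell n m} → c ~ d → transpose c ~ transpose d
  transpose~ (inj₁ e) = inj₂ e
  transpose~ (inj₂ e) = inj₁ e

columnDominators : {M : Cell n m → Set} {i : Fin n} {k : Fin m} → IsTotal2Dominatingᶜ M →
  (∀ {j} → k ≢ j → ¬ M (i , j)) → TwoDistinct (λ r → i ≢ r × M (r , k))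
columnDominators {M = M} {i} {k} dom off = alongColumn (dom (i , k))
  where
  inColumn : ∀ {r c} → (i , k) ~ (r , c) → M (r , c) → k ≡ c × i ≢ r
  inColumn (inj₁ (refl , k≢c)) Mrc = ⊥-elim (off k≢c Mrc)
  inColumn (inj₂ k≡c,i≢r)      _   = k≡c,i≢r

  alongColumn : Dominated₂ M (i , k) → TwoDistinct (λ r → i ≢ r × M (r , k))
  alongColumn ((r , _) , (r′ , _) , p≢q , Mp , Mq , v~p , v~q)
    with inColumn v~p Mp | inColumn v~q Mq
  ... | refl , i≢r | refl , i≢r′ = pair r r′ (λ { refl → p≢q refl }) (i≢r , Mp) (i≢r′ , Mq)

rowDominators : {M : Cell n m → Set} {i : Fin n} {k : Fin m} → IsTotal2Dominatingᶜ M →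
  (∀ {r} → i ≢ r → ¬ M (r , k)) → TwoDistinct (λ j → k ≢ j × M (i , j))
rowDominators dom = columnDominators (transpose-dominating dom)

ColumnDoubled : Subset (n * m) → Fin m → Set
ColumnDoubled {n} S j = TwoDistinct {n} (λ i → (i , j) ∈ᶜ S)

RowDoubled : Subset (n * m) → Fin n → Set
RowDoubled {m = m} S i = TwoDistinct {m} (λ j → (i , j) ∈ᶜ S)

columnDoubled? : (S : Subset (n * m)) → Decidable (ColumnDoubled {n} S)
columnDoubled? S j = twoDistinct? λ i → (i , j) ∈ᶜ? S

columnsDoubled⇒2m≤∣S∣ : (S : Subset (n * m)) → (∀ j → ColumnDoubled {n} S j) → 2 * m ≤ ∣ S ∣
columnsDoubled⇒2m≤∣S∣ {n} {m} S doubled = ≤-trans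
  (≤-reflexive (trans (*-comm 2 m) (sym (∣⊤∣≡n (m * 2)))))
  (∣∣-mono-injectiveᶜ ⊤ S (cell ∘ pick) (λ {c} _ → pick∈ c) λ _ _ → pick-injective ∘ cell-injective)
  where
  open TwoDistinct
  pick : Cell m 2 → Cell n m
  pick (j , zero)  = one (doubled j) , j
  pick (j , suc _) = two (doubled j) , j

  pick∈ : ∀ c → pick c ∈ᶜ S
  pick∈ (j , zero)  = one∈ (doubled j)
  pick∈ (j , suc zero) = two∈ (doubled j)

  pick-injective : ∀ {c d} → pick c ≡ pick d → c ≡ d
  pick-injective {j , zero}     {_ , zero}     refl = refl
  pick-injective {j , suc zero} {_ , suc zero} refl = refl
  pick-injective {j , zero}     {_ , suc zero} e with refl ← cong proj₂ e =
    ⊥-elim (one≢two (doubled j) (cong proj₁ e))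
  pick-injective {j , suc zero} {_ , zero}     e with refl ← cong proj₂ e =
    ⊥-elim (one≢two (doubled j) (sym (cong proj₁ e)))

rowsSparse⇒columnsDoubled : (S : Subset (suc n * m)) → IsTotal2Dominatingᶜ {suc n} (_∈ᶜ S) →
  (∀ i → ¬ RowDoubled {suc n} S i) → ∀ k → ColumnDoubled {suc n} S k
rowsSparse⇒columnsDoubled S dom sparse k = fromMember (memberOfColumn (dom (zero , k)))
  where
  memberOfColumn : Dominated₂ (_∈ᶜ S) (zero , k) → ∃ λ r → (r , k) ∈ᶜ S
  memberOfColumn ((r , _) , _ , _ , p∈ , _ , inj₂ (refl , _) , _) = r , p∈
  memberOfColumn (_ , (r , _) , _ , _ , q∈ , _ , inj₂ (refl , _)) = r , q∈
  memberOfColumn ((_ , c) , (_ , c′) , p≢q , p∈ , q∈ , inj₁ (refl , _) , inj₁ (refl , _)) =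
    ⊥-elim (sparse zero (pair c c′ (λ { refl → p≢q refl }) p∈ q∈))

  fromMember : (∃ λ r → (r , k) ∈ᶜ S) → ColumnDoubled S k
  fromMember (r , rk∈) =
    TwoDistinct-map proj₂ (columnDominators {i = r} dom λ k≢j rj∈ → sparse r (pair k _ k≢j rk∈ rj∈))

record Extendable {n m} (S : Subset (n * m)) : Set where
  field
    dominating : IsTotal2Dominatingᶜ {n} (_∈ᶜ S)
    rowsMet    : (i : Fin n) → ∃ λ j → (i , j) ∈ᶜ S
    doubledRow : ∃ (RowDoubled {n} S)

extendable⊎columnsDoubled : (S : Subset (suc n * m)) → IsTotal2Dominatingᶜ {suc n} (_∈ᶜ S) →
  Extendable {suc n} S ⊎ (∀ k → ColumnDoubled {suc n} S k)
extendable⊎columnsDoubled {n} S dom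
  with all? (λ i → any? λ j → (i , j) ∈ᶜ? S)
     | any? (λ (i : Fin (suc n)) → twoDistinct? λ j → (i , j) ∈ᶜ? S)
... | yes met | yes doubled =
  inj₁ (record { dominating = dom ; rowsMet = met ; doubledRow = doubled })
... | yes _   | no ¬doubled = inj₂ (rowsSparse⇒columnsDoubled S dom λ i d → ¬doubled (i , d))
... | no ¬met | _ with ¬∀⟶∃¬ (suc n) _ (λ i → any? λ j → (i , j) ∈ᶜ? S) ¬met
...   | i , emptyRow =
  inj₂ λ k → TwoDistinct-map proj₂ (columnDominators {i = i} dom λ _ ij∈ → emptyRow (_ , ij∈))

addColumn : {S : Subset (n * m)} → Extendable {n} {m} S →
  Σ (Subset (n * suc m)) λ S′ → Extendable {n} S′ × ∣ S′ ∣ ≤ suc ∣ S ∣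
addColumn {n} {m} {S} ext = gridSubset Widened? , extendable , size
  where
  open Extendable ext
  x : Fin n
  x = proj₁ doubledRow

  Widened : Cell n (suc m) → Set
  Widened (i , zero)  = i ≡ x
  Widened (i , suc j) = (i , j) ∈ᶜ S

  Widened? : Decidable Widened
  Widened? (i , zero)  = i ≟ x
  Widened? (i , suc j) = (i , j) ∈ᶜ? S

  shift : Cell n m → Cell n (suc m)
  shift (i , j) = i , suc j

  shift-injective : ∀ {c d} → shift c ≡ shift d → c ≡ d
  shift-injective refl = refl

  shift~ : ∀ {c d} → c ~ d → shift c ~ shift d
  shift~ (inj₁ (i≡i′ , j≢j′)) = inj₁ (i≡i′ , j≢j′ ∘ suc-injective)
  shift~ (inj₂ (j≡j′ , i≢i′)) = inj₂ (cong suc j≡j′ , i≢i′)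

  dominated : IsTotal2Dominatingᶜ Widened
  dominated (i , suc j) with dominating (i , j)
  ... | p , q , p≢q , p∈ , q∈ , v~p , v~q =
    shift p , shift q , p≢q ∘ shift-injective , p∈ , q∈ , shift~ v~p , shift~ v~q
  dominated (i , zero) with i ≟ x | proj₂ doubledRow | rowsMet i
  ... | yes refl | pair y y′ y≢y′ y∈ y′∈ | _ =
    (x , suc y) , (x , suc y′) , y≢y′ ∘ suc-injective ∘ cong proj₂ , y∈ , y′∈ ,
    inj₁ (refl , λ ()) , inj₁ (refl , λ ())
  ... | no i≢x | _ | y , y∈ =
    (x , zero) , (i , suc y) , (λ ()) , refl , y∈ , inj₂ (refl , i≢x) , inj₁ (refl , λ ())

  widened∈ : ∀ {c} → Widened c → c ∈ᶜ gridSubset Widened?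
  widened∈ = ∈gridSubset⁺ Widened?

  extendable : Extendable (gridSubset Widened?)
  extendable = record
    { dominating = IsTotal2Dominatingᶜ-mono widened∈ dominated
    ; rowsMet    = λ i → suc (proj₁ (rowsMet i)) , widened∈ (proj₂ (rowsMet i))
    ; doubledRow = x , TwoDistinct-map widened∈ (shiftRow (proj₂ doubledRow))
    }
    where
    shiftRow : TwoDistinct (λ j → (x , j) ∈ᶜ S) → TwoDistinct (λ j → Widened (x , j))
    shiftRow (pair y y′ y≢y′ y∈ y′∈) = pair (suc y) (suc y′) (y≢y′ ∘ suc-injective) y∈ y′∈

  flatten : Cell n (suc m) → Fin (suc (n * m))
  flatten (i , zero)  = zero
  flatten (i , suc j) = suc (cell (i , j))

  flatten∈ : ∀ {c} → Widened c → flatten c ∈ inside ∷ S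
  flatten∈ {_ , zero}  _   = here
  flatten∈ {_ , suc _} ij∈ = there ij∈

  flatten-injective : ∀ {c d} → Widened c → Widened d → flatten c ≡ flatten d → c ≡ d
  flatten-injective {_ , zero}  {_ , zero}  refl refl _ = refl
  flatten-injective {_ , suc _} {_ , suc _} _    _    e =
    cong shift (cell-injective (suc-injective e))

  size : ∣ gridSubset Widened? ∣ ≤ suc ∣ S ∣
  size = ∣∣-mono-injectiveᶜ (gridSubset Widened?) (inside ∷ S) flatten
    (flatten∈ ∘ ∈gridSubset⁻ Widened?)
    λ c∈ d∈ → flatten-injective (∈gridSubset⁻ Widened? c∈) (∈gridSubset⁻ Widened? d∈)

addColumns : ∀ d {S : Subset (n * m)} → Extendable {n} {m} S →
  Σ (Subset (n * (d + m))) λ S′ → Extendable {n} S′ × ∣ S′ ∣ ≤ d + ∣ S ∣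
addColumns zero    {S} ext = S , ext , ≤-refl
addColumns (suc d)     ext with addColumns d ext
... | S′ , ext′ , S′≤ with addColumn ext′
...   | S″ , ext″ , S″≤ = S″ , ext″ , ≤-trans S″≤ (s≤s S′≤)

record ThreeDistinct (P : Fin n → Set) : Set where
  constructor triple
  field
    one two three : Fin n
    one≢two       : one ≢ two
    one≢three     : one ≢ three
    two≢three     : two ≢ three
    one∈          : P one
    two∈          : P two
    three∈        : P three

twoAvoiding : {P : Fin n → Set} → ThreeDistinct P → (k : Fin n) → TwoDistinct (λ c → k ≢ c × P c)
twoAvoiding (triple a b c a≢b a≢c b≢c pa pb pc) k with k ≟ a | k ≟ b
... | yes refl | _        = pair b c b≢c (a≢b , pb) (a≢c , pc)
... | no k≢a   | yes refl = pair a c a≢c (k≢a , pa) (b≢c , pc)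
... | no k≢a   | no k≢b   = pair a b a≢b (k≢a , pa) (k≢b , pb)

module _ {S : Subset (n * suc m)} (j : Fin (suc m)) where

  offColumn : {i a : Fin n} {k : Fin m} {b : Fin (suc m)} →
    (i , j) ∉ᶜ S → (a , b) ∈ᶜ S → (i , punchIn j k) ~ (a , b) → j ≢ b
  offColumn         ij∉ ab∈ (inj₁ (refl , _))  refl = ij∉ ab∈
  offColumn {k = k} _   _   (inj₂ (jk≡j , _)) refl = punchInᵢ≢i j k jk≡j

  punchIn-punchOut∈ : {a : Fin n} {b : Fin (suc m)} (j≢b : j ≢ b) →
    (a , b) ∈ᶜ S → (a , punchIn j (punchOut j≢b)) ∈ᶜ S
  punchIn-punchOut∈ {a} j≢b = subst (λ c → (a , c) ∈ᶜ S) (sym (punchIn-punchOut j≢b))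

  punchOut~ : {i a : Fin n} {k : Fin m} {b : Fin (suc m)} (j≢b : j ≢ b) →
    (i , punchIn j k) ~ (a , b) → (i , k) ~ (a , punchOut j≢b)
  punchOut~ j≢b (inj₁ (i≡a , jk≢b)) =
    inj₁ (i≡a , λ k≡ → jk≢b (trans (cong (punchIn j) k≡) (punchIn-punchOut j≢b)))
  punchOut~ {k = k} j≢b (inj₂ (jk≡b , i≢a)) =
    inj₂ (punchIn-injective j k _ (trans jk≡b (sym (punchIn-punchOut j≢b))) , i≢a)

  -- A cell whose row meets column j is dominated within its row; every other cell keeps
  -- its old dominators, none of which lay in column j.
  deleteColumn-dominating : {N : Cell n m → Set} → IsTotal2Dominatingᶜ (_∈ᶜ S) →
    (∀ {i k} → (i , punchIn j k) ∈ᶜ S → N (i , k)) →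
    (∀ {i} → (i , j) ∈ᶜ S → ThreeDistinct (λ k → N (i , k))) →
    IsTotal2Dominatingᶜ N
  deleteColumn-dominating {N} dom kept rowKept (i , k) with (i , j) ∈ᶜ? S
  ... | yes ij∈ = alongRow (twoAvoiding (rowKept ij∈) k)
    where
    alongRow : TwoDistinct (λ c → k ≢ c × N (i , c)) → Dominated₂ N (i , k)
    alongRow (pair c c′ c≢c′ (k≢c , Nc) (k≢c′ , Nc′)) =
      (i , c) , (i , c′) , c≢c′ ∘ cong proj₂ , Nc , Nc′ , inj₁ (refl , k≢c) , inj₁ (refl , k≢c′)
  ... | no ij∉ = squeezed (dom (i , punchIn j k))
    where
    squeezed : Dominated₂ (_∈ᶜ S) (i , punchIn j k) → Dominated₂ N (i , k)
    squeezed ((a , b) , (a′ , b′) , p≢q , p∈ , q∈ , v~p , v~q) =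
      (a , punchOut j≢b) , (a′ , punchOut j≢b′) ,
      (λ e → p≢q (cong₂ _,_ (cong proj₁ e) (punchOut-injective j≢b j≢b′ (cong proj₂ e)))) ,
      kept (punchIn-punchOut∈ j≢b p∈) , kept (punchIn-punchOut∈ j≢b′ q∈) ,
      punchOut~ j≢b v~p , punchOut~ j≢b′ v~q
      where
      j≢b : j ≢ b
      j≢b = offColumn ij∉ p∈ v~p
      j≢b′ : j ≢ b′
      j≢b′ = offColumn ij∉ q∈ v~q

-- The cells of column j move to column k₀ of their rows, and the remaining columns close up
-- over the gap; `origin` sends a cell of the smaller grid to the cell of S it comes from.
module ColumnDeletion (S : Subset (n * suc m)) (j : Fin (suc m)) (k₀ : Fin m) where

  Moved : Fin n → Fin m → Set
  Moved i k = k ≡ k₀ × (i , j) ∈ᶜ S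

  origin′ : ∀ i k → Dec (Moved i k) → Cell n (suc m)
  origin′ i k (yes _) = i , j
  origin′ i k (no _)  = i , punchIn j k

  origin : Cell n m → Cell n (suc m)
  origin (i , k) = origin′ i k (k ≟ k₀ ×-dec (i , j) ∈ᶜ? S)

  origin′-injective : ∀ {i k i′ k′} d d′ → origin′ i k d ≡ origin′ i′ k′ d′ → (i , k) ≡ (i′ , k′)
  origin′-injective (yes (refl , _)) (yes (refl , _)) refl = refl
  origin′-injective {k′ = k′} (yes _) (no _) e = ⊥-elim (punchInᵢ≢i j k′ (sym (cong proj₂ e)))
  origin′-injective {k = k}   (no _) (yes _) e = ⊥-elim (punchInᵢ≢i j k (cong proj₂ e))
  origin′-injective {k = k}   (no _) (no _)  e =
    cong₂ _,_ (cong proj₁ e) (punchIn-injective j k _ (cong proj₂ e))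

  Kept : Cell n m → Set
  Kept c = origin c ∈ᶜ S

  deleted : Subset (n * m)
  deleted = gridSubset (λ c → origin c ∈ᶜ? S)

  kept-punchIn : ∀ {i k} → (i , punchIn j k) ∈ᶜ S → Kept (i , k)
  kept-punchIn {i} {k} ik∈ with k ≟ k₀ ×-dec (i , j) ∈ᶜ? S
  ... | yes (_ , ij∈) = ij∈
  ... | no _          = ik∈

  kept-k₀ : ∀ {i} → (i , j) ∈ᶜ S → Kept (i , k₀)
  kept-k₀ {i} ij∈ with k₀ ≟ k₀ ×-dec (i , j) ∈ᶜ? S
  ... | yes _   = ij∈
  ... | no ¬moved = ⊥-elim (¬moved (refl , ij∈))

  ∣deleted∣≤∣S∣ : ∣ deleted ∣ ≤ ∣ S ∣
  ∣deleted∣≤∣S∣ = ∣∣-mono-injectiveᶜ deleted S (cell ∘ origin) (∈gridSubset⁻ (λ c → origin c ∈ᶜ? S))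
    λ {(i , k)} {(i′ , k′)} _ _ e →
      origin′-injective (k ≟ k₀ ×-dec (i , j) ∈ᶜ? S) (k′ ≟ k₀ ×-dec (i′ , j) ∈ᶜ? S) (cell-injective e)

  deleted-dominating : IsTotal2Dominatingᶜ {n} (_∈ᶜ S) →
    (∀ {i} → (i , j) ∈ᶜ S → ThreeDistinct (λ k → Kept (i , k))) →
    IsTotal2Dominatingᶜ {n} (_∈ᶜ deleted)
  deleted-dominating dom rowKept = IsTotal2Dominatingᶜ-mono (∈gridSubset⁺ (λ c → origin c ∈ᶜ? S))
    (deleteColumn-dominating j dom kept-punchIn rowKept)

deleteSparseColumn : 3 ≤ m → (S : Subset (n * suc m)) → IsTotal2Dominatingᶜ {n} (_∈ᶜ S) →
  (j : Fin (suc m)) → ¬ ColumnDoubled {n} S j →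
  Σ (Subset (n * m)) λ S′ → IsTotal2Dominatingᶜ {n} (_∈ᶜ S′) × ∣ S′ ∣ ≤ ∣ S ∣
deleteSparseColumn {suc _} {n} (s≤s _) S dom j _ with any? (λ i → (i , j) ∈ᶜ? S)
... | no empty = deleted , deleted-dominating dom (λ ij∈ → ⊥-elim (empty (_ , ij∈))) , ∣deleted∣≤∣S∣
  where open ColumnDeletion {n} S j zero
deleteSparseColumn {n = n} 3≤m S dom j ¬doubled | yes (i₀ , i₀j∈)
  with rowDominators {i = i₀} {k = j} dom (λ i₀≢r rj∈ → i₀≢r (¬TwoDistinct⇒unique ¬doubled i₀j∈ rj∈))
... | pair b b′ b≢b′ (j≢b , b∈) (j≢b′ , b′∈) with fresh 3≤m (punchOut j≢b) (punchOut j≢b′)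
...   | k₀ , c≢k₀ , c′≢k₀ = deleted , deleted-dominating dom rowKept , ∣deleted∣≤∣S∣
  where
  open ColumnDeletion {n} S j k₀
  rowKept : ∀ {i} → (i , j) ∈ᶜ S → ThreeDistinct (λ k → Kept (i , k))
  rowKept ij∈ with refl ← ¬TwoDistinct⇒unique ¬doubled ij∈ i₀j∈ =
    triple (punchOut j≢b) (punchOut j≢b′) k₀ (b≢b′ ∘ punchOut-injective j≢b j≢b′) c≢k₀ c′≢k₀
      (kept-punchIn (punchIn-punchOut∈ {S = S} j {a = i₀} j≢b b∈))
      (kept-punchIn (punchIn-punchOut∈ {S = S} j {a = i₀} j≢b′ b′∈))
      (kept-k₀ i₀j∈)

2≤d+n : 3 ≤ n → ∀ d → 2 ≤ d + n
2≤d+n {n} 3≤n d = ≤-trans (n≤1+n 2) (≤-trans 3≤n (m≤n+m n d))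

γ₂ₜ-lowerBound : 3 ≤ n → ∀ {a} → IsGamma2t (K n □ K n) a →
  ∀ d (S : Subset (n * (d + n))) → IsTotal2Dominatingᶜ {n} (_∈ᶜ S) → a ≤ ∣ S ∣
γ₂ₜ-lowerBound 3≤n γa zero    S dom = proj₂ γa S (fromCells dom)
γ₂ₜ-lowerBound {n} 3≤n γa (suc d) S dom with all? (columnDoubled? S)
... | yes doubled =
  ≤-trans (γ₂ₜ≤2n 3≤n (2≤d+n 3≤n 0) γa)
          (≤-trans (*-monoʳ-≤ 2 (m≤n+m n (suc d))) (columnsDoubled⇒2m≤∣S∣ S doubled))
... | no ¬allDoubled with ¬∀⟶∃¬ _ _ (columnDoubled? S) ¬allDoubled
...   | j , ¬doubled with deleteSparseColumn (≤-trans 3≤n (m≤n+m n d)) S dom j ¬doubled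
...     | S′ , dom′ , ∣S′∣≤∣S∣ = ≤-trans (γ₂ₜ-lowerBound 3≤n γa d S′ dom′) ∣S′∣≤∣S∣

γ₂ₜ-upperBound : 3 ≤ n → ∀ {a} → IsGamma2t (K n □ K n) a →
  ∀ d {b} → IsGamma2t (K n □ K (d + n)) b → b ≤ a + d
γ₂ₜ-upperBound {suc n} 3≤n ((S , domS , refl) , _) d γb
  with extendable⊎columnsDoubled S (toCells domS)
... | inj₂ doubled =
  ≤-trans (γ₂ₜ≤2n 3≤n (2≤d+n 3≤n d) γb) (≤-trans (columnsDoubled⇒2m≤∣S∣ S doubled) (m≤m+n ∣ S ∣ d))
... | inj₁ extendable with addColumns d extendable
...   | S′ , extendable′ , ∣S′∣≤ =
  ≤-trans (proj₂ γb S′ (fromCells (Extendable.dominating extendable′)))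
          (≤-trans ∣S′∣≤ (≤-reflexive (+-comm d ∣ S ∣)))

γ₂ₜ-bounds : 3 ≤ n → ∀ d → Σ ℕ λ a → Σ ℕ λ b →
  IsGamma2t (K n □ K n) a × IsGamma2t (K n □ K (d + n)) b × a ≤ b × b ≤ (2 * n) ⊓ (a + d)
γ₂ₜ-bounds 3≤n d with γ₂ₜ-exists′ 3≤n (2≤d+n 3≤n 0) | γ₂ₜ-exists′ 3≤n (2≤d+n 3≤n d)
... | a , γa | b , γb@((S , domS , refl) , _) =
  a , b , γa , γb , γ₂ₜ-lowerBound 3≤n γa d S (toCells domS) ,
  ⊓-glb (γ₂ₜ≤2n 3≤n (2≤d+n 3≤n d) γb) (γ₂ₜ-upperBound 3≤n γa d γb)

proposition2p17 : (n m : ℕ) → 3 ≤ n → n ≤ m →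
    Σ ℕ λ a → Σ ℕ λ b →
      IsGamma2t (K n □ K n) a × IsGamma2t (K n □ K m) b ×
      a ≤ b × b ≤ (2 * n) ⊓ (a + (m ∸ n))
proposition2p17 n m 3≤n n≤m = subst
  (λ m′ → Σ ℕ λ a → Σ ℕ λ b → IsGamma2t (K n □ K n) a × IsGamma2t (K n □ K m′) b ×
                               a ≤ b × b ≤ (2 * n) ⊓ (a + (m ∸ n)))
  (m∸n+n≡m n≤m) (γ₂ₜ-bounds 3≤n (m ∸ n))
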